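{- Let $T$ be a tree with an almost perfect matching $M$, and suppose the contree of $T$ (with respect to $M$) is $0$-rotatable. Then $T$ is graceful.
   Context: A matching $M$ of a tree $T$ is almost perfect if every vertex of $T$, except at most one, is incident with an edge of $M$. The contree of $T$ with respect to $M$ is the tree obtained from $T$ by contracting the edges of $M$. A tree with $n$ edges is graceful if there is an injective map $f$ from its vertices to $\{0,\ldots,n\}$ such that the induced edge labels $|f(x)-f(y)|$ are exactly $\{1,\ldots,n\}$ (such $f$ is a graceful labeling). A tree $S$ is $0$-rotatable if for every vertex $u$ of $S$ there is a graceful labeling $f$ of $S$ with $f(u)=0$. -}

module Defs where

open import Data.Nat using (ℕ; suc; _≤_; ∣_-_∣)
open import Data.Fin using (Fin)
open import Data.List using (List; length; lookup)
open import Data.Bool using (Bool; true; false)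
open import Data.Product using (Σ; ∃; ∃-syntax; _×_; _,_; proj₁; proj₂)
open import Data.Sum using (_⊎_)
open import Relation.Binary.PropositionalEquality using (_≡_; _≢_)
open import Function.Definitions using (Injective; Surjective)

-- A finite (multi)graph: vertices are Fin vertices, edges a list of
-- (unordered) pairs of vertices.
record Graph : Set where
  constructor graph
  field
    vertices : ℕ
    edges    : List (Fin vertices × Fin vertices)

open Graph public

Edge : Graph → Set
Edge G = Fin (length (edges G))

src tgt : (G : Graph) → Edge G → Fin (vertices G)
src G i = proj₁ (lookup (edges G) i)
tgt G i = proj₂ (lookup (edges G) i)

Joins : (G : Graph) → Edge G → Fin (vertices G) → Fin (vertices G) → Set
Joins G i x y = (src G i ≡ x × tgt G i ≡ y) ⊎ (src G i ≡ y × tgt G i ≡ x)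

Incident : (G : Graph) → Edge G → Fin (vertices G) → Set
Incident G i x = src G i ≡ x ⊎ tgt G i ≡ x

data Reach (G : Graph) : Fin (vertices G) → Fin (vertices G) → Set where
  here : ∀ {x} → Reach G x x
  step : ∀ {x y z} (i : Edge G) → Joins G i x y → Reach G y z → Reach G x z

Connected : Graph → Set
Connected G = ∀ x y → Reach G x y

-- A tree: at least one vertex, connected, with exactly |V| - 1 edges
-- (this standard characterisation also excludes loops and multiple edges).
IsTree : Graph → Set
IsTree G = Σ ℕ λ k → (vertices G ≡ suc k) × (length (edges G) ≡ k) × Connected G

IsGracefulLabeling : (G : Graph) → (Fin (vertices G) → ℕ) → Set
IsGracefulLabeling G f =
  Injective _≡_ _≡_ f
  × (∀ x → f x ≤ length (edges G))
  × (∀ i → 1 ≤ ∣ f (src G i) - f (tgt G i) ∣ × ∣ f (src G i) - f (tgt G i) ∣ ≤ length (edges G))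
  × (∀ k → 1 ≤ k → k ≤ length (edges G) → ∃[ i ] ∣ f (src G i) - f (tgt G i) ∣ ≡ k)

Graceful : Graph → Set
Graceful G = ∃[ f ] IsGracefulLabeling G f

ZeroRotatable : Graph → Set
ZeroRotatable S = ∀ u → ∃[ f ] (IsGracefulLabeling S f × f u ≡ 0)

IsMatching : (G : Graph) → (Edge G → Bool) → Set
IsMatching G M = ∀ i j x → M i ≡ true → M j ≡ true →
  Incident G i x → Incident G j x → i ≡ j

Covered : (G : Graph) → (Edge G → Bool) → Fin (vertices G) → Set
Covered G M x = ∃[ i ] (M i ≡ true × Incident G i x)

IsAlmostPerfectMatching : (G : Graph) → (Edge G → Bool) → Set
IsAlmostPerfectMatching G M =
  IsMatching G M × (∀ x y → (Covered G M x → Data.Empty.⊥) → (Covered G M y → Data.Empty.⊥) → x ≡ y)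
  where import Data.Empty

-- S is (isomorphic to) the graph obtained from T by contracting the edges of M:
-- φ maps vertices of T onto vertices of S, identifying exactly the endpoints of
-- M-edges, and ψ is a bijection from the edges of S onto the edges of T not in
-- M, such that each edge of S joins the images of the ends of its T-edge.
IsContree : (T : Graph) → (Edge T → Bool) → Graph → Set
IsContree T M S =
  Σ (Fin (vertices T) → Fin (vertices S)) λ φ →
  Σ (Edge S → Edge T) λ ψ →
    Surjective _≡_ _≡_ φ
    × (∀ x y → φ x ≡ φ y → x ≡ y ⊎ ∃[ i ] (M i ≡ true × Joins T i x y))
    × (∀ i x y → M i ≡ true → Joins T i x y → φ x ≡ φ y)
    × Injective _≡_ _≡_ ψ
    × (∀ j → M (ψ j) ≡ false)
    × (∀ i → M i ≡ false → ∃[ j ] ψ j ≡ i)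
    × (∀ j → Joins S j (φ (src T (ψ j))) (φ (tgt T (ψ j))))

module Submission where

open import Defs
open import Data.Bool using (Bool)
open import Data.Product using (∃-syntax; _×_)

open import Data.Bool using (true; false; not; _xor_)
import Data.Bool.Properties as Bool
open import Data.Nat using (ℕ; zero; suc; pred; _+_; _*_; _∸_; _≤_; _<_; z≤n; s≤s; ∣_-_∣)
open import Data.Nat.Properties
open import Data.Nat.Tactic.RingSolver using (solve-∀)
open import Data.Fin as F using (Fin; zero; suc; toℕ; fromℕ<; punchOut; splitAt; join)
open import Data.Fin.Properties
  using (injective⇒≤; punchOut-injective; toℕ-fromℕ<; toℕ-injective; toℕ<n; any?; splitAt-join; join-splitAt)
open import Data.Vec.Functional using (_∷_; updateAt)
open import Data.Vec.Functional.Properties using (updateAt-updates; updateAt-minimal)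
open import Data.Sum using (_⊎_; inj₁; inj₂)
open import Data.Sum.Properties using (inj₁-injective; inj₂-injective)
open import Data.Product using (Σ; ∃; _,_; proj₁; proj₂)
open import Data.List using (length)
open import Function using (_∘_)
open import Function.Definitions using (Injective; Surjective)
open import Relation.Binary.PropositionalEquality
open import Relation.Nullary using (¬_; Dec; yes; no; ¬?)
open import Relation.Nullary.Decidable using (_×-dec_; _⊎-dec_)
open import Relation.Nullary.Negation using (contradiction)

-- Let m be the number of edges of S, φ the contraction map, and r the
-- vertex left uncovered by M (any vertex if M is perfect).  Colour T so that
-- exactly the edges of M join vertices of different colours, with r of
-- colour false, and take a graceful labelling g of S with g (φ r) = 0.
-- Label a vertex x of T by 2·g(φ x) if its colour is false and by
-- 2m + 1 − 2·g(φ x) otherwise.  An unmatched edge then gets twice the label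
-- of its contree edge (the even labels 2, …, 2m), and a matched edge, whose
-- ends lie over one contree vertex of label k, gets the odd label
-- |4k − (2m + 1)|; all these labels are distinct and positive.  The vertex
-- labels are exactly [0, 2m + 1] if M is perfect and [0, 2m] otherwise, so
-- by counting vertices they lie in [0, |E(T)|] and the labelling is graceful.

retraction⇒injective : ∀ {A B : Set} {h : A → B} (r : B → A) →
                       (∀ x → r (h x) ≡ x) → Injective _≡_ _≡_ h
retraction⇒injective {h = h} r rh {x} {y} hx≡hy = begin
  x         ≡⟨ sym (rh x) ⟩
  r (h x)   ≡⟨ cong r hx≡hy ⟩
  r (h y)   ≡⟨ rh y ⟩
  y         ∎
  where open ≡-Reasoning

injective⇒surjective : ∀ {a} (h : Fin a → Fin a) → Injective _≡_ _≡_ h →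
                       ∀ y → ∃ λ x → h x ≡ y
injective⇒surjective {suc a} h h-inj y with any? (λ x → h x F.≟ y)
... | yes hit = hit
... | no miss = contradiction (injective⇒≤ h′-inj) (<-irrefl refl)
  where
  y≢h : ∀ x → y ≢ h x
  y≢h x y≡hx = miss (x , sym y≡hx)
  -- omitting the value y, h becomes an injection Fin (suc a) → Fin a
  h′ : Fin (suc a) → Fin a
  h′ x = punchOut (y≢h x)
  h′-inj : Injective _≡_ _≡_ h′
  h′-inj {x} {x′} e = h-inj (punchOut-injective (y≢h x) (y≢h x′) e)

-- An onto endomap of a finite set is injective: a chosen section is
-- injective, hence onto, and is then a left inverse of h.
surjective⇒injective : ∀ {a} (h : Fin a → Fin a) → (∀ y → ∃ λ x → h x ≡ y) →
                       Injective _≡_ _≡_ h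
surjective⇒injective {a} h onto = retraction⇒injective section section-retracts
  where
  section : Fin a → Fin a
  section y = proj₁ (onto y)
  section-onto : ∀ x → ∃ λ y → section y ≡ x
  section-onto = injective⇒surjective section
    (retraction⇒injective h (λ y → proj₂ (onto y)))
  section-retracts : ∀ x → section (h x) ≡ x
  section-retracts x with y , refl ← section-onto x = cong section (proj₂ (onto y))

module _ {a b : ℕ} (h : Fin a → ℕ) (h<b : ∀ x → h x < b) where

  toFin : Fin a → Fin b
  toFin x = fromℕ< (h<b x)

  toFin-injective : Injective _≡_ _≡_ h → Injective _≡_ _≡_ toFin
  toFin-injective h-inj {x} {y} e =
    h-inj (trans (sym (toℕ-fromℕ< (h<b x))) (trans (cong toℕ e) (toℕ-fromℕ< (h<b y))))

  injective⇒≤ℕ : Injective _≡_ _≡_ h → a ≤ b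
  injective⇒≤ℕ h-inj = injective⇒≤ (toFin-injective h-inj)

injective⇒onto : ∀ {a} (h : Fin a → ℕ) → (∀ x → h x < a) → Injective _≡_ _≡_ h →
                 ∀ y → y < a → ∃ λ x → h x ≡ y
injective⇒onto h h<a h-inj y y<a
  with x , e ← injective⇒surjective (toFin h h<a) (toFin-injective h h<a h-inj) (fromℕ< y<a) =
  x , trans (sym (toℕ-fromℕ< (h<a x))) (trans (cong toℕ e) (toℕ-fromℕ< y<a))

onto⇒injective : ∀ {a} (h : Fin a → ℕ) → (∀ x → h x < a) →
                 (∀ y → y < a → ∃ λ x → h x ≡ y) → Injective _≡_ _≡_ h
onto⇒injective h h<a onto {x} {x′} e =
  surjective⇒injective (toFin h h<a) toFin-onto (toℕ-injective (begin
    toℕ (toFin h h<a x)    ≡⟨ toℕ-fromℕ< (h<a x) ⟩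
    h x                    ≡⟨ e ⟩
    h x′                   ≡⟨ sym (toℕ-fromℕ< (h<a x′)) ⟩
    toℕ (toFin h h<a x′)   ∎))
  where
  open ≡-Reasoning
  toFin-onto : ∀ y → ∃ λ x → toFin h h<a x ≡ y
  toFin-onto y with x , hx≡y ← onto (toℕ y) (toℕ<n y) =
    x , toℕ-injective (trans (toℕ-fromℕ< (h<a x)) hx≡y)

onto⇒≤ : ∀ {a b} (h : Fin a → ℕ) → (∀ y → y < b → ∃ λ x → h x ≡ y) → b ≤ a
onto⇒≤ {a} {b} h onto = injective⇒≤ {f = preimage} preimage-injective
  where
  preimage : Fin b → Fin a
  preimage y = proj₁ (onto (toℕ y) (toℕ<n y))
  preimage-injective : Injective _≡_ _≡_ preimage
  preimage-injective {y} {y′} e = toℕ-injective (begin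
    toℕ y             ≡⟨ sym (proj₂ (onto (toℕ y) (toℕ<n y))) ⟩
    h (preimage y)    ≡⟨ cong h e ⟩
    h (preimage y′)   ≡⟨ proj₂ (onto (toℕ y′) (toℕ<n y′)) ⟩
    toℕ y′            ∎)
    where open ≡-Reasoning

⊎-injective⇒≤ : ∀ {a b c d} (h : Fin a ⊎ Fin b → Fin c ⊎ Fin d) →
                Injective _≡_ _≡_ h → a + b ≤ c + d
⊎-injective⇒≤ {a} {b} {c} {d} h h-inj = injective⇒≤ {f = h′} h′-inj
  where
  h′ : Fin (a + b) → Fin (c + d)
  h′ x = join c d (h (splitAt a x))
  h′-inj : Injective _≡_ _≡_ h′
  h′-inj e = retraction⇒injective (join a b) (join-splitAt a b)
    (h-inj (retraction⇒injective (splitAt c) (splitAt-join c d) e))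

-- A map Fin a → [1, a] is injective exactly when it is onto; shifting the
-- values down by one reduces this to maps into [0, a).
module _ {a} (h : Fin a → ℕ) (h-range : ∀ x → 1 ≤ h x × h x ≤ a) where

  private
    shifted : Fin a → ℕ
    shifted x = pred (h x)

    unshift : ∀ x → suc (shifted x) ≡ h x
    unshift x with h x | proj₁ (h-range x)
    ... | suc _ | _ = refl

    shifted<a : ∀ x → shifted x < a
    shifted<a x = subst (_≤ a) (sym (unshift x)) (proj₂ (h-range x))

    shifted-injective : Injective _≡_ _≡_ h → Injective _≡_ _≡_ shifted
    shifted-injective h-inj {x} {x′} e =
      h-inj (trans (sym (unshift x)) (trans (cong suc e) (unshift x′)))

  positive-injective⇒onto : Injective _≡_ _≡_ h → ∀ y → 1 ≤ y → y ≤ a → ∃ λ x → h x ≡ y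
  positive-injective⇒onto h-inj (suc y) _ y<a
    with x , e ← injective⇒onto shifted shifted<a (shifted-injective h-inj) y y<a =
    x , trans (sym (unshift x)) (cong suc e)

  positive-onto⇒injective : (∀ y → 1 ≤ y → y ≤ a → ∃ λ x → h x ≡ y) → Injective _≡_ _≡_ h
  positive-onto⇒injective onto e = onto⇒injective shifted shifted<a shifted-onto (cong pred e)
    where
    shifted-onto : ∀ y → y < a → ∃ λ x → shifted x ≡ y
    shifted-onto y y<a with x , e ← onto (suc y) (s≤s z≤n) y<a = x , cong pred e

parity : ∀ l → (∃ λ q → l ≡ 2 * q) ⊎ (∃ λ q → l ≡ suc (2 * q))
parity zero = inj₁ (0 , refl)
parity (suc l) with parity l
... | inj₁ (q , l≡2q)  = inj₂ (q , cong suc l≡2q)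
... | inj₂ (q , l≡2q+1) = inj₁ (suc q , trans (cong suc l≡2q+1) (sym (*-distribˡ-+ 2 1 q)))

even≤odd⇒≤ : ∀ {q m} → 2 * q ≤ suc (2 * m) → q ≤ m
even≤odd⇒≤ {q} {m} 2q≤2m+1 = *-cancelˡ-≤ 2 (≤-pred (≤∧≢⇒< 2q≤2m+1 (even≢odd q m)))

∣-∣-split : ∀ a b → a ≡ b + ∣ a - b ∣ ⊎ b ≡ a + ∣ a - b ∣
∣-∣-split zero    b       = inj₂ refl
∣-∣-split (suc a) zero    = inj₁ refl
∣-∣-split (suc a) (suc b) with ∣-∣-split a b
... | inj₁ e = inj₁ (cong suc e)
... | inj₂ e = inj₂ (cong suc e)

∣-∣-reflection : ∀ x y c → ∣ x - c ∣ ≡ ∣ y - c ∣ → x ≡ y ⊎ x + y ≡ 2 * c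
∣-∣-reflection x y c e =
  symmetric (∣-∣-split x c) (subst (λ d → y ≡ c + d ⊎ c ≡ y + d) (sym e) (∣-∣-split y c))
  where
  symmetric : ∀ {x y c d} → x ≡ c + d ⊎ c ≡ x + d → y ≡ c + d ⊎ c ≡ y + d →
              x ≡ y ⊎ x + y ≡ 2 * c
  symmetric (inj₁ refl) (inj₁ refl) = inj₁ refl
  symmetric {x} {y} {d = d} (inj₂ c≡x+d) (inj₂ c≡y+d) =
    inj₁ (+-cancelʳ-≡ d x y (trans (sym c≡x+d) c≡y+d))
  symmetric {y = y} {d = d} (inj₁ refl) (inj₂ refl) = inj₂ (above+below y d)
    where
    above+below : ∀ y d → y + d + d + y ≡ 2 * (y + d)
    above+below = solve-∀
  symmetric {x = x} {d = d} (inj₂ refl) (inj₁ refl) = inj₂ (below+above x d)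
    where
    below+above : ∀ x d → x + (x + d + d) ≡ 2 * (x + d)
    below+above = solve-∀

∣∸-∸∣ : ∀ {c x y} → x ≤ c → y ≤ c → ∣ c ∸ x - c ∸ y ∣ ≡ ∣ x - y ∣
∣∸-∸∣ {c} {x} {y} x≤c y≤c = begin
  ∣ c ∸ x - c ∸ y ∣                      ≡⟨ ∣m+n-m+o∣≡∣n-o∣ (x + y) (c ∸ x) (c ∸ y) ⟨
  ∣ x + y + (c ∸ x) - x + y + (c ∸ y) ∣  ≡⟨ cong₂ ∣_-_∣ (shift x y x≤c)
                                               (trans (cong (_+ (c ∸ y)) (+-comm x y)) (shift y x y≤c)) ⟩
  ∣ c + y - c + x ∣                      ≡⟨ ∣m+n-m+o∣≡∣n-o∣ c y x ⟩
  ∣ y - x ∣                              ≡⟨ ∣-∣-comm y x ⟩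
  ∣ x - y ∣                              ∎
  where
  open ≡-Reasoning
  shift : ∀ u v → u ≤ c → u + v + (c ∸ u) ≡ c + v
  shift u v u≤c = begin
    u + v + (c ∸ u)    ≡⟨ cong (_+ (c ∸ u)) (+-comm u v) ⟩
    v + u + (c ∸ u)    ≡⟨ +-assoc v u (c ∸ u) ⟩
    v + (u + (c ∸ u))  ≡⟨ cong (v +_) (m+[n∸m]≡n u≤c) ⟩
    v + c              ≡⟨ +-comm v c ⟩
    c + v              ∎

∣-∣-complement : ∀ {a c} → a ≤ c → ∣ a - c ∸ a ∣ ≡ ∣ 2 * a - c ∣
∣-∣-complement {a} {c} a≤c = begin
  ∣ a - c ∸ a ∣               ≡⟨ ∣m+n-m+o∣≡∣n-o∣ a a (c ∸ a) ⟨
  ∣ a + a - a + (c ∸ a) ∣     ≡⟨ cong₂ ∣_-_∣ (cong (a +_) (+-identityʳ a)) (sym (m+[n∸m]≡n a≤c)) ⟨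
  ∣ 2 * a - c ∣               ∎
  where open ≡-Reasoning

∣even-odd∣≢even : ∀ a b q → ∣ 2 * a - suc (2 * b) ∣ ≢ 2 * q
∣even-odd∣≢even a b q d≡2q with ∣-∣-split (2 * a) (suc (2 * b))
... | inj₁ e = even≢odd a (b + q) (begin
  2 * a                   ≡⟨ e ⟩
  suc (2 * b) + ∣ 2 * a - suc (2 * b) ∣ ≡⟨ cong (suc (2 * b) +_) d≡2q ⟩
  suc (2 * b + 2 * q)     ≡⟨ cong suc (*-distribˡ-+ 2 b q) ⟨
  suc (2 * (b + q))       ∎)
  where open ≡-Reasoning
... | inj₂ e = even≢odd (a + q) b (sym (begin
  suc (2 * b)             ≡⟨ e ⟩
  2 * a + ∣ 2 * a - suc (2 * b) ∣ ≡⟨ cong (2 * a +_) d≡2q ⟩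
  2 * a + 2 * q           ≡⟨ *-distribˡ-+ 2 a q ⟨
  2 * (a + q)             ∎))
  where open ≡-Reasoning

module DoubledLabels (m : ℕ) where

  C : ℕ
  C = suc (2 * m)

  lab : Bool → ℕ → ℕ
  lab false k = 2 * k
  lab true  k = C ∸ 2 * k

  2k≤C : ∀ {k} → k ≤ m → 2 * k ≤ C
  2k≤C k≤m = m≤n⇒m≤1+n (*-monoʳ-≤ 2 k≤m)

  lab-≤ : ∀ b {k} → k ≤ m → lab b k ≤ C
  lab-≤ false k≤m = 2k≤C k≤m
  lab-≤ true {k} _ = m∸n≤m C (2 * k)

  lab-true-odd : ∀ {k} → k ≤ m → lab true k ≡ suc (2 * (m ∸ k))
  lab-true-odd {k} k≤m = begin
    suc (2 * m) ∸ 2 * k   ≡⟨ +-∸-assoc 1 (*-monoʳ-≤ 2 k≤m) ⟩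
    suc (2 * m ∸ 2 * k)   ≡⟨ cong suc (*-distribˡ-∸ 2 m k) ⟨
    suc (2 * (m ∸ k))     ∎
    where open ≡-Reasoning

  lab-injective : ∀ b b′ {k k′} → k ≤ m → k′ ≤ m → lab b k ≡ lab b′ k′ → b ≡ b′ × k ≡ k′
  lab-injective false false {k} {k′} _ _ e = refl , *-cancelˡ-≡ k k′ 2 e
  lab-injective true  true  {k} {k′} k≤m k′≤m e =
    refl , *-cancelˡ-≡ k k′ 2 (∸-cancelˡ-≡ (2k≤C k≤m) (2k≤C k′≤m) e)
  lab-injective false true  {k} {k′} _ k′≤m e =
    contradiction (trans e (lab-true-odd k′≤m)) (even≢odd k (m ∸ k′))
  lab-injective true  false {k} {k′} k≤m _ e =
    contradiction (trans (sym e) (lab-true-odd k≤m)) (even≢odd k′ (m ∸ k))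

  lab-spread : ∀ b {k k′} → k ≤ m → k′ ≤ m → ∣ lab b k - lab b k′ ∣ ≡ 2 * ∣ k - k′ ∣
  lab-spread false {k} {k′} _ _ = sym (*-distribˡ-∣-∣ 2 k k′)
  lab-spread true {k} {k′} k≤m k′≤m =
    trans (∣∸-∸∣ (2k≤C k≤m) (2k≤C k′≤m)) (sym (*-distribˡ-∣-∣ 2 k k′))

  cross : ℕ → ℕ
  cross k = ∣ lab false k - lab true k ∣

  cross-either : ∀ b b′ k → b ≢ b′ → ∣ lab b k - lab b′ k ∣ ≡ cross k
  cross-either false true  k _ = refl
  cross-either true  false k _ = ∣-∣-comm (lab true k) (lab false k)
  cross-either false false k b≢b = contradiction refl b≢b
  cross-either true  true  k b≢b = contradiction refl b≢b

  cross-odd : ∀ {k} → k ≤ m → ∀ q → cross k ≢ 2 * q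
  cross-odd {k} k≤m q rewrite lab-true-odd k≤m = ∣even-odd∣≢even k (m ∸ k) q

  cross-injective : ∀ {k k′} → k ≤ m → k′ ≤ m → cross k ≡ cross k′ → k ≡ k′
  cross-injective {k} {k′} k≤m k′≤m e
    with ∣-∣-reflection (2 * (2 * k)) (2 * (2 * k′)) C
           (trans (sym (∣-∣-complement (2k≤C k≤m))) (trans e (∣-∣-complement (2k≤C k′≤m))))
  ... | inj₁ 4k≡4k′ = *-cancelˡ-≡ k k′ 2 (*-cancelˡ-≡ (2 * k) (2 * k′) 2 4k≡4k′)
  ... | inj₂ 4k+4k′≡2C = contradiction
          (trans (*-distribˡ-+ 2 k k′) (*-cancelˡ-≡ (2 * k + 2 * k′) C 2
            (trans (*-distribˡ-+ 2 (2 * k) (2 * k′)) 4k+4k′≡2C)))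
          (even≢odd (k + k′) m)

  lab-onto : ∀ l → l ≤ C →
             Σ Bool λ b → Σ ℕ λ k → k ≤ m × lab b k ≡ l × (b ≡ true → k ≡ 0 → l ≡ C)
  lab-onto l l≤C with parity l
  ... | inj₁ (q , refl) = false , q , even≤odd⇒≤ l≤C , refl , λ ()
  ... | inj₂ (q , refl) = true , m ∸ q , m∸n≤m m q , lab-odd , at-zero
    where
    q≤m : q ≤ m
    q≤m = *-cancelˡ-≤ 2 (≤-pred l≤C)
    lab-odd : lab true (m ∸ q) ≡ suc (2 * q)
    lab-odd = trans (lab-true-odd (m∸n≤m m q)) (cong (λ z → suc (2 * z)) (m∸[m∸n]≡n q≤m))
    at-zero : true ≡ true → m ∸ q ≡ 0 → suc (2 * q) ≡ C
    at-zero _ m∸q≡0 = cong (λ z → suc (2 * z)) (≤-antisym q≤m (m∸n≡0⇒m≤n m∸q≡0))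

-- Colour facts.  Giving b the colour a xor e makes an edge with mark e
-- between a and b correct, in either orientation.
xor-solves : ∀ a e → a xor (a xor e) ≡ e
xor-solves a e = trans (sym (Bool.xor-assoc a a e)) (cong (_xor e) (Bool.xor-same a))

xor-solves′ : ∀ a e → (a xor e) xor a ≡ e
xor-solves′ a e = trans (Bool.xor-comm (a xor e) a) (xor-solves a e)

≢-≢⇒≡ : ∀ {a b c : Bool} → a ≢ c → b ≢ c → a ≡ b
≢-≢⇒≡ a≢c b≢c = trans (Bool.¬-not a≢c) (sym (Bool.¬-not b≢c))

xor≡false⇒≡ : ∀ a b → a xor b ≡ false → a ≡ b
xor≡false⇒≡ false false _ = refl
xor≡false⇒≡ true  true  _ = refl

xor≡true⇒≢ : ∀ a b → a xor b ≡ true → a ≢ b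
xor≡true⇒≢ false false () refl
xor≡true⇒≢ true  true  () refl
xor≡true⇒≢ false true  _ ()
xor≡true⇒≢ true  false _ ()

edgeLabel : (G : Graph) → (Fin (vertices G) → ℕ) → Edge G → ℕ
edgeLabel G f i = ∣ f (src G i) - f (tgt G i) ∣

-- A vertex labelling into [0, |E|] is graceful as soon as it is injective
-- and its edge labels are positive and distinct: the |E| edge labels then
-- fill [1, |E|] by counting.
gracefulCriterion : (G : Graph) (f : Fin (vertices G) → ℕ) → Injective _≡_ _≡_ f →
                    (∀ x → f x ≤ length (edges G)) →
                    (∀ i → 1 ≤ edgeLabel G f i) → Injective _≡_ _≡_ (edgeLabel G f) →
                    IsGracefulLabeling G f
gracefulCriterion G f f-inj f≤n positive labels-inj =
  f-inj , f≤n , range , positive-injective⇒onto (edgeLabel G f) range labels-inj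
  where
  range : ∀ i → 1 ≤ edgeLabel G f i × edgeLabel G f i ≤ length (edges G)
  range i = positive i , ≤-trans (∣m-n∣≤m⊔n (f (src G i)) (f (tgt G i)))
                                  (⊔-lub (f≤n (src G i)) (f≤n (tgt G i)))

covered? : (G : Graph) (M : Edge G → Bool) → ∀ x → Dec (Covered G M x)
covered? G M x = any? (λ i → (M i Bool.≟ true) ×-dec ((src G i F.≟ x) ⊎-dec (tgt G i F.≟ x)))

other-end : ∀ G {i x} → Incident G i x → ∃ λ y → Joins G i x y
other-end G {i} (inj₁ s≡x) = tgt G i , inj₁ (s≡x , refl)
other-end G {i} (inj₂ t≡x) = src G i , inj₂ (refl , t≡x)

joins-incidentˡ : ∀ G {i x y} → Joins G i x y → Incident G i x
joins-incidentˡ _ (inj₁ (s≡x , _)) = inj₁ s≡x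
joins-incidentˡ _ (inj₂ (_ , t≡x)) = inj₂ t≡x

joins-incidentʳ : ∀ G {i x y} → Joins G i x y → Incident G i y
joins-incidentʳ _ (inj₁ (_ , t≡y)) = inj₂ t≡y
joins-incidentʳ _ (inj₂ (s≡y , _)) = inj₁ s≡y

incident-end : ∀ G {P : Fin (vertices G) → Set} {i y} → P (src G i) → P (tgt G i) → Incident G i y → P y
incident-end _ ps _  (inj₁ refl) = ps
incident-end _ _  pt (inj₂ refl) = pt

joined-incident : ∀ G {i x x′ y} → Joins G i x x′ → Incident G i y → y ≡ x ⊎ y ≡ x′
joined-incident _ (inj₁ (refl , refl)) (inj₁ refl) = inj₁ refl
joined-incident _ (inj₁ (refl , refl)) (inj₂ refl) = inj₂ refl
joined-incident _ (inj₂ (refl , refl)) (inj₁ refl) = inj₂ refl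
joined-incident _ (inj₂ (refl , refl)) (inj₂ refl) = inj₁ refl

-- The
-- colouring is grown from a root r one edge at a time: after t steps t+1
-- vertices are explored and t distinct edges are correctly coloured; after
-- |E| steps every edge is.
module ParityColouring (G : Graph) (M : Edge G → Bool) where

  Vertex : Set
  Vertex = Fin (vertices G)

  _∈ᵛ_ : ∀ {t} → Vertex → (Fin t → Vertex) → Set
  x ∈ᵛ vs = ∃ λ j → vs j ≡ x

  _∈ᵛ?_ : ∀ {t} x (vs : Fin t → Vertex) → Dec (x ∈ᵛ vs)
  x ∈ᵛ? vs = any? (λ j → vs j F.≟ x)

  Respects : (Vertex → Bool) → Edge G → Set
  Respects col i = col (src G i) xor col (tgt G i) ≡ M i

  record Partial (r : Vertex) (t : ℕ) : Set where
    field
      explored     : Fin (suc t) → Vertex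
      colour       : Vertex → Bool
      done         : Fin t → Edge G
      done-inj     : Injective _≡_ _≡_ done
      done-ends    : ∀ j → src G (done j) ∈ᵛ explored × tgt G (done j) ∈ᵛ explored
      done-correct : ∀ j → Respects colour (done j)
      root         : r ∈ᵛ explored
      root-colour  : colour r ≡ false

  record Exit {t} (vs : Fin t → Vertex) : Set where
    field
      edge      : Edge G
      inside    : Vertex
      outside   : Vertex
      joins     : Joins G edge inside outside
      is-inside : inside ∈ᵛ vs
      is-out    : ¬ outside ∈ᵛ vs

  exit : ∀ {t} (vs : Fin t → Vertex) {x y} → Reach G x y → x ∈ᵛ vs → ¬ y ∈ᵛ vs → Exit vs
  exit vs here x∈ y∉ = contradiction x∈ y∉
  exit vs (step {y = x′} i joins w) x∈ y∉ with x′ ∈ᵛ? vs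
  ... | yes x′∈ = exit vs w x′∈ y∉
  ... | no x′∉ = record { edge = i ; joins = joins ; is-inside = x∈ ; is-out = x′∉ }

  there : ∀ {t x} {vs : Fin t → Vertex} (y : Vertex) → x ∈ᵛ vs → x ∈ᵛ (y ∷ vs)
  there _ (j , e) = suc j , e

  extend : ∀ {r t} (p : Partial r t) → Exit (Partial.explored p) → Partial r (suc t)
  extend {r} {t} p ex = record
    { explored     = b ∷ explored
    ; colour       = colour′
    ; done         = i ∷ done
    ; done-inj     = done′-inj
    ; done-ends    = done′-ends
    ; done-correct = done′-correct
    ; root         = there b root
    ; root-colour  = trans (colour′-old r root) root-colour
    }
    where
    open Partial p
    open Exit ex renaming (edge to i; inside to a; outside to b; is-inside to a∈; is-out to b∉)

    colour′ : Vertex → Bool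
    colour′ = updateAt colour b (λ _ → colour a xor M i)

    colour′-old : ∀ z → z ∈ᵛ explored → colour′ z ≡ colour z
    colour′-old z z∈ = updateAt-minimal z b colour (λ z≡b → b∉ (subst (_∈ᵛ explored) z≡b z∈))

    colour′-new : colour′ b ≡ colour a xor M i
    colour′-new = updateAt-updates b colour

    -- i is new, since one of its ends is unexplored
    i-new : ∀ j → done j ≢ i
    i-new j refl = b∉ (incident-end G (proj₁ (done-ends j)) (proj₂ (done-ends j)) (joins-incidentʳ G joins))

    done′-inj : Injective _≡_ _≡_ (i ∷ done)
    done′-inj {zero}  {zero}   _ = refl
    done′-inj {zero}  {suc j′} e = contradiction (sym e) (i-new j′)
    done′-inj {suc j} {zero}   e = contradiction e (i-new j)
    done′-inj {suc j} {suc j′} e = cong suc (done-inj e)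

    done′-ends : ∀ j → src G ((i ∷ done) j) ∈ᵛ (b ∷ explored) × tgt G ((i ∷ done) j) ∈ᵛ (b ∷ explored)
    done′-ends zero with joins
    ... | inj₁ (s≡a , t≡b) = subst (_∈ᵛ _) (sym s≡a) (there b a∈) , (zero , sym t≡b)
    ... | inj₂ (s≡b , t≡a) = (zero , sym s≡b) , subst (_∈ᵛ _) (sym t≡a) (there b a∈)
    done′-ends (suc j) = there b (proj₁ (done-ends j)) , there b (proj₂ (done-ends j))

    done′-correct : ∀ j → Respects colour′ ((i ∷ done) j)
    done′-correct zero with joins
    ... | inj₁ (s≡a , t≡b) = begin
      colour′ (src G i) xor colour′ (tgt G i)
        ≡⟨ cong₂ _xor_ (trans (cong colour′ s≡a) (colour′-old a a∈))
                       (trans (cong colour′ t≡b) colour′-new) ⟩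
      colour a xor (colour a xor M i)  ≡⟨ xor-solves (colour a) (M i) ⟩
      M i                              ∎
      where open ≡-Reasoning
    ... | inj₂ (s≡b , t≡a) = begin
      colour′ (src G i) xor colour′ (tgt G i)
        ≡⟨ cong₂ _xor_ (trans (cong colour′ s≡b) colour′-new)
                       (trans (cong colour′ t≡a) (colour′-old a a∈)) ⟩
      (colour a xor M i) xor colour a  ≡⟨ xor-solves′ (colour a) (M i) ⟩
      M i                              ∎
      where open ≡-Reasoning
    done′-correct (suc j) = begin
      colour′ (src G (done j)) xor colour′ (tgt G (done j))
        ≡⟨ cong₂ _xor_ (colour′-old _ (proj₁ (done-ends j))) (colour′-old _ (proj₂ (done-ends j))) ⟩
      colour (src G (done j)) xor colour (tgt G (done j))  ≡⟨ done-correct j ⟩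
      M (done j)                                          ∎
      where open ≡-Reasoning

  module _ (V≡1+E : vertices G ≡ suc (length (edges G))) (connected : Connected G) (r : Vertex) where

    unexplored : ∀ {t} → t < length (edges G) → (vs : Fin (suc t) → Vertex) → ∃ λ y → ¬ y ∈ᵛ vs
    unexplored {t} t<E vs with any? (λ y → ¬? (y ∈ᵛ? vs))
    ... | yes found = found
    ... | no none = contradiction (subst (_≤ suc t) V≡1+E (injective⇒≤ index-inj)) (<⇒≱ (s≤s t<E))
      where
      every : ∀ y → y ∈ᵛ vs
      every y with y ∈ᵛ? vs
      ... | yes y∈ = y∈
      ... | no y∉ = contradiction (y , y∉) none
      index-inj : Injective _≡_ _≡_ (λ y → proj₁ (every y))
      index-inj = retraction⇒injective vs (λ y → proj₂ (every y))

    grow : ∀ t → t ≤ length (edges G) → Partial r t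
    grow zero _ = record
      { explored = λ _ → r ; colour = λ _ → false
      ; done = λ () ; done-inj = λ { {()} } ; done-ends = λ () ; done-correct = λ ()
      ; root = zero , refl ; root-colour = refl }
    grow (suc t) t<E = extend p (exit explored (connected r y) root y∉)
      where
      p : Partial r t
      p = grow t (≤-trans (n≤1+n t) t<E)
      open Partial p
      y : Vertex
      y = proj₁ (unexplored t<E explored)
      y∉ : ¬ y ∈ᵛ explored
      y∉ = proj₂ (unexplored t<E explored)

    -- after |E| steps every edge is done, as `done` is an injective endomap
    parityColouring : ∃ λ (c : Vertex → Bool) → (∀ i → Respects c i) × c r ≡ false
    parityColouring = colour , correct , root-colour
      where
      open Partial (grow (length (edges G)) ≤-refl)
      correct : ∀ i → Respects colour i
      correct i with j , refl ← injective⇒surjective done done-inj i = done-correct j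

module Construction
  (T : Graph) (V≡1+n : vertices T ≡ suc (length (edges T)))
  (M : Edge T → Bool) (matching : IsMatching T M)
  (S : Graph) (φ : Fin (vertices T) → Fin (vertices S)) (ψ : Edge S → Edge T)
  (φ-onto : Surjective _≡_ _≡_ φ)
  (φ-fibres : ∀ x y → φ x ≡ φ y → x ≡ y ⊎ ∃[ i ] (M i ≡ true × Joins T i x y))
  (φ-contracts : ∀ i x y → M i ≡ true → Joins T i x y → φ x ≡ φ y)
  (ψ-inj : Injective _≡_ _≡_ ψ)
  (ψ-unmatched : ∀ j → M (ψ j) ≡ false)
  (ψ-onto : ∀ i → M i ≡ false → ∃[ j ] ψ j ≡ i)
  (ψ-joins : ∀ j → Joins S j (φ (src T (ψ j))) (φ (tgt T (ψ j))))
  (c : Fin (vertices T) → Bool) (c-parity : ∀ i → c (src T i) xor c (tgt T i) ≡ M i)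
  (r : Fin (vertices T)) (r-only : ∀ x → ¬ Covered T M x → x ≡ r) (c-r : c r ≡ false)
  (g : Fin (vertices S) → ℕ) (g-graceful : IsGracefulLabeling S g) (g-r : g (φ r) ≡ 0)
  where

  Vertex : Set
  Vertex = Fin (vertices T)

  m : ℕ
  m = length (edges S)

  open DoubledLabels m

  matched-ends-differ : ∀ {i x y} → M i ≡ true → Joins T i x y → c x ≢ c y
  matched-ends-differ {i} Mi (inj₁ (refl , refl)) = xor≡true⇒≢ _ _ (trans (c-parity i) Mi)
  matched-ends-differ {i} Mi (inj₂ (refl , refl)) = xor≡true⇒≢ _ _ (trans (c-parity i) Mi) ∘ sym

  unmatched-same : ∀ i → M i ≡ false → c (src T i) ≡ c (tgt T i)
  unmatched-same i Mi = xor≡false⇒≡ _ _ (trans (c-parity i) Mi)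

  fibre-colour : ∀ x y → φ x ≡ φ y → c x ≡ c y → x ≡ y
  fibre-colour x y φx≡φy cx≡cy with φ-fibres x y φx≡φy
  ... | inj₁ x≡y = x≡y
  ... | inj₂ (i , Mi , joins) = contradiction cx≡cy (matched-ends-differ Mi joins)

  -- only r can be uncovered, and it has colour false
  true-covered : ∀ x → c x ≡ true → Covered T M x
  true-covered x cx with covered? T M x
  ... | yes covered = covered
  ... | no uncovered with () ← trans (sym cx) (trans (cong c (r-only x uncovered)) c-r)

  partner : ∀ x → Covered T M x → ∃ λ y → c y ≢ c x × φ y ≡ φ x
  partner x (i , Mi , incident) with y , joins ← other-end T incident =
    y , matched-ends-differ Mi joins ∘ sym , sym (φ-contracts i x y Mi joins)

  matched-fibre : ∀ {i i′} → M i ≡ true → M i′ ≡ true → φ (src T i) ≡ φ (src T i′) → i ≡ i′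
  matched-fibre {i} {i′} Mi Mi′ e with φ-fibres (src T i) (src T i′) e
  ... | inj₁ s≡s′ = matching i i′ (src T i) Mi Mi′ (inj₁ refl) (inj₁ (sym s≡s′))
  ... | inj₂ (i″ , Mi″ , joins) = trans
          (matching i i″ (src T i) Mi Mi″ (inj₁ refl) (joins-incidentˡ T joins))
          (sym (matching i′ i″ (src T i′) Mi′ Mi″ (inj₁ refl) (joins-incidentʳ T joins)))

  g-inj : Injective _≡_ _≡_ g
  g-inj = proj₁ g-graceful

  g≤m : ∀ v → g v ≤ m
  g≤m = proj₁ (proj₂ g-graceful)

  h : Vertex → ℕ
  h x = g (φ x)

  h≤m : ∀ x → h x ≤ m
  h≤m x = g≤m (φ x)

  vertex-code : ∀ x b → c x ≡ b → Edge T ⊎ Fin (vertices S)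
  vertex-code x true  cx = inj₁ (proj₁ (true-covered x cx))
  vertex-code x false _  = inj₂ (φ x)

  code : Fin m ⊎ Vertex → Edge T ⊎ Fin (vertices S)
  code (inj₁ j) = inj₁ (ψ j)
  code (inj₂ x) = vertex-code x (c x) refl

  vertex-code-inj : ∀ x y bx by (cx : c x ≡ bx) (cy : c y ≡ by) →
                    vertex-code x bx cx ≡ vertex-code y by cy → x ≡ y
  vertex-code-inj x y true true cx cy e
    with i , Mi , x∈i ← true-covered x cx | _ , _ , y∈i ← true-covered y cy | refl ← inj₁-injective e
    with x′ , joins ← other-end T x∈i | joined-incident T joins y∈i
  ... | inj₁ y≡x = sym y≡x
  ... | inj₂ refl = contradiction (trans cx (sym cy)) (matched-ends-differ Mi joins)
  vertex-code-inj x y false false cx cy e = fibre-colour x y (inj₂-injective e) (trans cx (sym cy))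

  -- unmatched and matched edges are distinct
  edge≢vertex : ∀ j y b (cy : c y ≡ b) → inj₁ (ψ j) ≢ vertex-code y b cy
  edge≢vertex j y true cy e with i , Mi , _ ← true-covered y cy | refl ← inj₁-injective e
    with () ← trans (sym (ψ-unmatched j)) Mi

  code-inj : Injective _≡_ _≡_ code
  code-inj {inj₁ j} {inj₁ j′} e = cong inj₁ (ψ-inj (inj₁-injective e))
  code-inj {inj₂ x} {inj₂ y}  e = cong inj₂ (vertex-code-inj x y (c x) (c y) refl refl e)
  code-inj {inj₁ j} {inj₂ y}  e = contradiction e (edge≢vertex j y (c y) refl)
  code-inj {inj₂ x} {inj₁ j}  e = contradiction (sym e) (edge≢vertex j x (c x) refl)

  -- S has m + 1 vertices: at most m + 1 since g is injective into [0, m],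
  -- at least m + 1 since the code gives m + (n + 1) ≤ n + |V(S)|.
  contree-size : vertices S ≡ suc m
  contree-size = ≤-antisym (injective⇒≤ℕ g (λ v → s≤s (g≤m v)) g-inj) (+-cancelˡ-≤ n _ _ (begin
    n + suc m            ≡⟨ +-suc n m ⟩
    suc (n + m)          ≡⟨ cong suc (+-comm n m) ⟩
    suc (m + n)          ≡⟨ +-suc m n ⟨
    m + suc n            ≡⟨ cong (m +_) V≡1+n ⟨
    m + vertices T       ≤⟨ ⊎-injective⇒≤ code code-inj ⟩
    n + vertices S       ∎))
    where
    open ≤-Reasoning
    n : ℕ
    n = length (edges T)

  g-onto : ∀ k → k ≤ m → ∃ λ v → g v ≡ k
  g-onto k k≤m = injective⇒onto g (λ v → subst (g v <_) (sym contree-size) (s≤s (g≤m v))) g-inj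
                   k (subst (k <_) (sym contree-size) (s≤s k≤m))

  contree-labels-inj : Injective _≡_ _≡_ (edgeLabel S g)
  contree-labels-inj = positive-onto⇒injective (edgeLabel S g)
    (proj₁ (proj₂ (proj₂ g-graceful))) (proj₂ (proj₂ (proj₂ g-graceful)))

  -- The labelling of T, injective since a label determines colour and fibre.
  f : Vertex → ℕ
  f x = lab (c x) (h x)

  f-inj : Injective _≡_ _≡_ f
  f-inj {x} {y} e with cx≡cy , hx≡hy ← lab-injective (c x) (c y) (h≤m x) (h≤m y) e =
    fibre-colour x y (g-inj hx≡hy) cx≡cy

  label-unmatched : ∀ j → edgeLabel T f (ψ j) ≡ 2 * edgeLabel S g j
  label-unmatched j = begin
    ∣ lab (c s) (h s) - lab (c t) (h t) ∣  ≡⟨ cong (λ b → ∣ lab (c s) (h s) - lab b (h t) ∣)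
                                                   (sym (unmatched-same (ψ j) (ψ-unmatched j))) ⟩
    ∣ lab (c s) (h s) - lab (c s) (h t) ∣  ≡⟨ lab-spread (c s) (h≤m s) (h≤m t) ⟩
    2 * ∣ h s - h t ∣                      ≡⟨ cong (2 *_) contree-label ⟩
    2 * edgeLabel S g j                    ∎
    where
    open ≡-Reasoning
    s t : Vertex
    s = src T (ψ j)
    t = tgt T (ψ j)
    contree-label : ∣ h s - h t ∣ ≡ edgeLabel S g j
    contree-label with ψ-joins j
    ... | inj₁ (s′≡φs , t′≡φt) = sym (cong₂ (λ u v → ∣ g u - g v ∣) s′≡φs t′≡φt)
    ... | inj₂ (s′≡φt , t′≡φs) =
      trans (∣-∣-comm (h s) (h t)) (sym (cong₂ (λ u v → ∣ g u - g v ∣) s′≡φt t′≡φs))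

  label-matched : ∀ i → M i ≡ true → edgeLabel T f i ≡ cross (h (src T i))
  label-matched i Mi = begin
    ∣ lab (c s) (h s) - lab (c t) (h t) ∣  ≡⟨ cong (λ k → ∣ lab (c s) (h s) - lab (c t) k ∣)
                                                   (cong g (φ-contracts i s t Mi (inj₁ (refl , refl)))) ⟨
    ∣ lab (c s) (h s) - lab (c t) (h s) ∣  ≡⟨ cross-either (c s) (c t) (h s)
                                                   (matched-ends-differ Mi (inj₁ (refl , refl))) ⟩
    cross (h s)                            ∎
    where
    open ≡-Reasoning
    s t : Vertex
    s = src T i
    t = tgt T i

  label-positive : ∀ i → 1 ≤ edgeLabel T f i
  label-positive i with M i in Mi
  ... | true  = n≢0⇒n>0 (cross-odd (h≤m (src T i)) 0 ∘ trans (sym (label-matched i Mi)))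
  ... | false with j , refl ← ψ-onto i Mi = begin
    1                         ≤⟨ proj₁ (proj₁ (proj₂ (proj₂ g-graceful)) j) ⟩
    edgeLabel S g j           ≤⟨ m≤m+n _ _ ⟩
    2 * edgeLabel S g j       ≡⟨ label-unmatched j ⟨
    edgeLabel T f (ψ j)       ∎
    where open ≤-Reasoning

  -- Unmatched edges get distinct even labels, matched edges distinct odd ones.
  label-inj : Injective _≡_ _≡_ (edgeLabel T f)
  label-inj {i} {i′} e with M i in Mi | M i′ in Mi′
  ... | false | false with j , refl ← ψ-onto i Mi | j′ , refl ← ψ-onto i′ Mi′ =
    cong ψ (contree-labels-inj (*-cancelˡ-≡ _ _ 2
      (trans (sym (label-unmatched j)) (trans e (label-unmatched j′)))))
  ... | true | true = matched-fibre Mi Mi′ (g-inj (cross-injective (h≤m _) (h≤m _)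
    (trans (sym (label-matched i Mi)) (trans e (label-matched i′ Mi′)))))
  ... | true | false with j′ , refl ← ψ-onto i′ Mi′ =
    contradiction (trans (sym (label-matched i Mi)) (trans e (label-unmatched j′)))
                  (cross-odd (h≤m _) (edgeLabel S g j′))
  ... | false | true with j , refl ← ψ-onto i Mi =
    contradiction (trans (sym (label-matched i′ Mi′)) (trans (sym e) (label-unmatched j)))
                  (cross-odd (h≤m _) (edgeLabel S g j))

  covered-unless-root : ∀ x b → c x ≢ b → (b ≡ true → h x ≡ 0 → Covered T M r) → Covered T M x
  covered-unless-root x b cx≢b r-covered with covered? T M x
  ... | yes covered = covered
  ... | no uncovered with refl ← r-only x uncovered =
    r-covered (trans (Bool.¬-not (cx≢b ∘ sym)) (cong not c-r)) g-r

  -- f takes the value lab b k (k ≤ m): pick x in the fibre over g⁻¹ k and,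
  -- if its colour is wrong, its partner.  Only the label lab true 0 = C may
  -- be missed, namely when r is uncovered.
  f-hits : ∀ b k → k ≤ m → (b ≡ true → k ≡ 0 → Covered T M r) → ∃ λ x → f x ≡ lab b k
  f-hits b k k≤m r-covered
    with v , gv≡k ← g-onto k k≤m
    with x , φx≡v ← φ-onto v
    with hx≡k ← trans (cong g (φx≡v refl)) gv≡k
    with c x Bool.≟ b
  ... | yes cx≡b = x , cong₂ lab cx≡b hx≡k
  ... | no cx≢b
    with y , cy≢cx , φy≡φx ← partner x (covered-unless-root x b cx≢b
                                          (λ b≡true hx≡0 → r-covered b≡true (trans (sym hx≡k) hx≡0)))
    = y , cong₂ lab (≢-≢⇒≡ cy≢cx (cx≢b ∘ sym)) (trans (cong g φy≡φx) hx≡k)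

  -- If f takes exactly the values in [0, B], counting the |E| + 1 vertices
  -- gives B ≤ |E|, and f is graceful.
  graceful-onto : ∀ B → (∀ x → f x ≤ B) → (∀ l → l ≤ B → ∃ λ x → f x ≡ l) →
                  IsGracefulLabeling T f
  graceful-onto B f≤B f-onto =
    gracefulCriterion T f f-inj (λ x → ≤-trans (f≤B x) B≤n) label-positive label-inj
    where
    B≤n : B ≤ length (edges T)
    B≤n = ≤-pred (subst (suc B ≤_) V≡1+n (onto⇒≤ f (λ l l<1+B → f-onto l (≤-pred l<1+B))))

  -- r covered (M perfect): the labels are exactly [0, C]
  graceful-covered : Covered T M r → IsGracefulLabeling T f
  graceful-covered r-covered = graceful-onto C (λ x → lab-≤ (c x) (h≤m x)) f-onto
    where
    f-onto : ∀ l → l ≤ C → ∃ λ x → f x ≡ l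
    f-onto l l≤C with b , k , k≤m , lab≡l , _ ← lab-onto l l≤C
                 with x , fx≡lab ← f-hits b k k≤m (λ _ _ → r-covered) = x , trans fx≡lab lab≡l

  -- r uncovered: the label C = lab true 0 is missed, the labels are [0, 2m]
  graceful-uncovered : ¬ Covered T M r → IsGracefulLabeling T f
  graceful-uncovered r-uncovered = graceful-onto (2 * m) f≤2m f-onto
    where
    f≢C : ∀ x → f x ≢ C
    f≢C x fx≡C with cx≡true , hx≡0 ← lab-injective (c x) true (h≤m x) z≤n fx≡C
                 with φ-fibres x r (g-inj (trans hx≡0 (sym g-r)))
    ... | inj₁ refl = contradiction (trans (sym cx≡true) c-r) (λ ())
    ... | inj₂ (i , Mi , joins) = r-uncovered (i , Mi , joins-incidentʳ T joins)
    f≤2m : ∀ x → f x ≤ 2 * m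
    f≤2m x = ≤-pred (≤∧≢⇒< (lab-≤ (c x) (h≤m x)) (f≢C x))
    f-onto : ∀ l → l ≤ 2 * m → ∃ λ x → f x ≡ l
    f-onto l l≤2m with b , k , k≤m , lab≡l , at-root ← lab-onto l (m≤n⇒m≤1+n l≤2m)
                  with x , fx≡lab ← f-hits b k k≤m (λ b≡true k≡0 →
                                      contradiction (subst (_≤ 2 * m) (at-root b≡true k≡0) l≤2m) 1+n≰n)
                  = x , trans fx≡lab lab≡l

  graceful : Graceful T
  graceful with covered? T M r
  ... | yes r-covered  = f , graceful-covered r-covered
  ... | no r-uncovered = f , graceful-uncovered r-uncovered

tree-size : ∀ G → IsTree G → vertices G ≡ suc (length (edges G))
tree-size G (k , V≡1+k , E≡k , _) = trans V≡1+k (cong suc (sym E≡k))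

-- An almost perfect matching singles out a vertex r that every uncovered
-- vertex equals: the uncovered vertex if there is one, else any vertex x₀.
matching-root : ∀ G (M : Edge G → Bool) → IsAlmostPerfectMatching G M → Fin (vertices G) →
                ∃ λ r → ∀ x → ¬ Covered G M x → x ≡ r
matching-root G M (_ , at-most-one) x₀ with any? (λ x → ¬? (covered? G M x))
... | yes (r , r-uncovered) = r , λ x x-uncovered → at-most-one x r x-uncovered r-uncovered
... | no none-uncovered = x₀ , λ x x-uncovered → contradiction (x , x-uncovered) none-uncovered

mainTheorem12 : (T : Graph) → IsTree T →
    (M : Edge T → Bool) → IsAlmostPerfectMatching T M →
    (∃[ S ] (IsContree T M S × ZeroRotatable S)) →
    Graceful T
mainTheorem12 T tree@(_ , _ , _ , connected) M almost-perfect
  (S , (φ , ψ , φ-onto , φ-fibres , φ-contracts , ψ-inj , ψ-unmatched , ψ-onto , ψ-joins) , zero-rotatable)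
  with V≡1+n ← tree-size T tree
  with r , r-only ← matching-root T M almost-perfect (subst Fin (sym V≡1+n) zero)
  with c , c-parity , c-r ← ParityColouring.parityColouring T M V≡1+n connected r
  with g , g-graceful , g-r ← zero-rotatable (φ r)
  = Construction.graceful T V≡1+n M (proj₁ almost-perfect) S φ ψ φ-onto φ-fibres φ-contracts
      ψ-inj ψ-unmatched ψ-onto ψ-joins c c-parity r r-only c-r g g-graceful g-r
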